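{- Every graph $G$ with maximum degree $\Delta$ has strong separation dimension at most $d+2\Delta+2$, where $d$ is the separation dimension of $G$.
   Context: A representation of a graph $G$ is a non-empty set of linear orderings of $V(G)$. Edges $e,f$ are separated in a linear ordering if both endpoints of $e$ precede both endpoints of $f$ or vice versa. The separation dimension of $G$ is the minimum size of a representation in which every pair of disjoint edges is separated in some ordering (equivalently, the minimum $d$ such that $V(G)$ embeds in $\mathbb{R}^d$ with every pair of disjoint edges separated by an axis-parallel hyperplane). A representation $\{<_1,\dots,<_p\}$ of $G$ is strongly separating if (a) for all disjoint edges $vw,xy\in E(G)$, for some $i$ we have $v,w<_i x,y$ or $x,y<_i v,w$; and (b) for every edge $vw\in E(G)$ and vertex $x\in V(G)\setminus\{v,w\}$, there are $i,j\in\{1,\dots,p\}$ with $x<_i v,w$ and $v,w<_j x$. The strong separation dimension of $G$ is the minimum number of orderings in a strongly separating representation of $G$. -}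

module Defs where

open import Data.Nat using (ℕ; suc; _≤_; _+_; _*_)
open import Data.Bool using (Bool; true; false; T)
open import Data.Fin using (Fin; _<_)
open import Data.Fin.Permutation using (Permutation′; _⟨$⟩ʳ_)
open import Data.Vec using (Vec; lookup)
open import Data.List using (length; filter; allFin)
open import Data.Product using (Σ; _×_; ∃; ∃-syntax)
open import Data.Sum using (_⊎_)
open import Relation.Nullary using (¬_)
open import Relation.Nullary.Decidable using (T?)
open import Relation.Binary.PropositionalEquality using (_≡_)

record Graph (n : ℕ) : Set where
  field
    adj    : Fin n → Fin n → Bool
    sym    : ∀ v w → adj v w ≡ adj w v
    irrefl : ∀ v → adj v v ≡ false

open Graph public

Edge : ∀ {n} → Graph n → Fin n → Fin n → Set
Edge G v w = adj G v w ≡ true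

degree : ∀ {n} → Graph n → Fin n → ℕ
degree {n} G v = length (filter (λ w → T? (adj G v w)) (allFin n))

MaxDegree : ∀ {n} → Graph n → ℕ → Set
MaxDegree {n} G Δ = (∀ v → degree G v ≤ Δ) × (∃[ v ] degree G v ≡ Δ)

-- A linear ordering of Fin n, given by a bijection assigning each vertex
-- its position; v precedes w iff position of v < position of w.
LinOrder : ℕ → Set
LinOrder n = Permutation′ n

_≺[_]_ : ∀ {n} → Fin n → LinOrder n → Fin n → Set
v ≺[ π ] w = (π ⟨$⟩ʳ v) < (π ⟨$⟩ʳ w)

Rep : ℕ → ℕ → Set
Rep n p = Vec (LinOrder n) p

Before : ∀ {n} → LinOrder n → Fin n → Fin n → Fin n → Fin n → Set
Before π v w x y = (v ≺[ π ] x) × (v ≺[ π ] y) × (w ≺[ π ] x) × (w ≺[ π ] y)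

DisjointEdges : ∀ {n} → Graph n → Fin n → Fin n → Fin n → Fin n → Set
DisjointEdges G v w x y =
  Edge G v w × Edge G x y × ¬ v ≡ x × ¬ v ≡ y × ¬ w ≡ x × ¬ w ≡ y

Separating : ∀ {n p} → Graph n → Rep n p → Set
Separating {n} {p} G R = ∀ v w x y → DisjointEdges G v w x y →
  ∃[ i ] (Before (lookup R i) v w x y ⊎ Before (lookup R i) x y v w)

StronglySeparating : ∀ {n p} → Graph n → Rep n p → Set
StronglySeparating {n} {p} G R = Separating G R ×
  (∀ v w x → Edge G v w → ¬ x ≡ v → ¬ x ≡ w →
     (∃[ i ] (x ≺[ lookup R i ] v × x ≺[ lookup R i ] w)) ×
     (∃[ j ] (v ≺[ lookup R j ] x × w ≺[ lookup R j ] x)))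

HasSepRep : ∀ {n} → Graph n → ℕ → Set
HasSepRep {n} G p = 1 ≤ p × Σ (Rep n p) (Separating G)

HasStrongSepRep : ∀ {n} → Graph n → ℕ → Set
HasStrongSepRep {n} G p = 1 ≤ p × Σ (Rep n p) (StronglySeparating G)

IsSepDim : ∀ {n} → Graph n → ℕ → Set
IsSepDim G d = HasSepRep G d × (∀ p → HasSepRep G p → d ≤ p)

IsStrongSepDim : ∀ {n} → Graph n → ℕ → Set
IsStrongSepDim G s = HasStrongSepRep G s × (∀ p → HasStrongSepRep G p → s ≤ p)

module Submission where

-- Colour G greedily with Δ+1 colours.  For each colour c let
-- firstOrder c list the vertices of colour c first and the rest afterwards,
-- both parts by vertex index, and let lastOrder c be its reverse.  Given an
-- edge vw (so col v ≠ col w) and a vertex x outside it, one of these 2(Δ+1)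
-- orders puts x before v and w (see ClassOrders.front); reversing it puts x
-- after them.  Appending the 2(Δ+1) orders to a separating representation of
-- size d therefore yields a strongly separating one of size d + 2Δ + 2.
--
-- The statement asks for the strong separation dimension itself,
-- so we show that "G has a strongly separating representation of size p" is
-- decidable (a representation matters only through its finite table of vertex
-- positions) and apply the least number principle below the bound.

open import Defs hiding (sym)
open import Data.Nat as ℕ using (ℕ; zero; suc; _≤_; _+_; _*_; s≤s)
import Data.Nat.Properties as ℕ
open import Data.Nat.Tactic.RingSolver using (solve-∀)
open import Data.Bool as Bool using (true; if_then_else_)
open import Data.Fin as Fin using (Fin; toℕ; opposite; combine; punchOut)
open import Data.Fin.Properties as Fin
  using (toℕ<n; toℕ-injective; injective⇒≤; punchOut-injective; opposite-prop; opposite-involutive; any?; all?)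
open import Data.Fin.Subset as Subset using (Subset; _⊂_; ⊤; ∣_∣)
open import Data.Fin.Subset.Properties using (p⊂q⇒∣p∣<∣q∣; ∈⊤; ∣⊤∣≡n)
open import Data.Fin.Permutation using (permutation; reverse; _∘ₚ_; _⟨$⟩ʳ_; _⟨$⟩ˡ_; inverseˡ)
open import Data.List as List using (List; filter; allFin)
open import Data.List.Membership.Propositional using (_∈_)
open import Data.List.Membership.Propositional.Properties using (∈-filter⁺; ∈-allFin)
import Data.List.Relation.Unary.Any as Any
open import Data.List.Relation.Unary.Any.Properties using (lookup-index)
open import Data.Vec using (Vec; []; _∷_; lookup; tabulate; _++_)
open import Data.Vec.Properties using (lookup∘tabulate; lookup-++ˡ; lookup-++ʳ; lookup⇒[]=; []=⇒lookup)
open import Data.Product as Product using (Σ; ∃; ∃-syntax; _×_; _,_; proj₁; proj₂)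
open import Data.Sum as Sum using (_⊎_; inj₁; inj₂)
open import Function.Base using (_∘_)
open import Function.Definitions using (Injective)
open import Relation.Nullary using (¬_; Dec; yes; no; contradiction)
open import Relation.Nullary.Decidable using (T?; does; dec-true; dec-false; map′; _×-dec_; _⊎-dec_; _→-dec_; ¬?)
open import Data.Bool.Properties using (T-≡)
open import Function.Bundles using (Equivalence)
open import Relation.Binary.Definitions using (tri<; tri≈; tri>)
open import Relation.Binary.PropositionalEquality using (_≡_; refl; sym; trans; cong; subst; subst₂; module ≡-Reasoning)

-- An injective endomap of a finite set is onto: a missed value y would let
-- Fin (suc m) inject into Fin m by punching y out of the codomain.
injective⇒onto : ∀ {n} {f : Fin n → Fin n} → Injective _≡_ _≡_ f → ∀ y → ∃ λ x → f x ≡ y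
injective⇒onto {suc m} {f} f-inj y with any? (λ x → f x Fin.≟ y)
... | yes hit = hit
... | no miss = contradiction (injective⇒≤ squeeze-inj) (ℕ.<-irrefl refl)
  where
  squeeze : Fin (suc m) → Fin m
  squeeze x = punchOut {i = y} (λ e → miss (x , sym e))
  squeeze-inj : Injective _≡_ _≡_ squeeze
  squeeze-inj e = f-inj (punchOut-injective {i = y} _ _ e)

fromInjection : ∀ {n} (f : Fin n → Fin n) → Injective _≡_ _≡_ f → LinOrder n
fromInjection f f-inj =
  permutation f (λ y → proj₁ (injective⇒onto f-inj y))
    (λ y → proj₂ (injective⇒onto f-inj y))
    (λ x → f-inj (proj₂ (injective⇒onto f-inj (f x))))

-- Ordering the vertices by an injective key.  The rank of v is the number of
-- vertices with a smaller key; ranks are positions in Fin n, strictly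
-- monotone in the key, hence injective.
module OrderByKey {n m : ℕ} (key : Fin n → Fin m) (key-inj : Injective _≡_ _≡_ key) where

  open Subset using () renaming (_∈_ to _∈ₛ_; _∉_ to _∉ₛ_)

  below : Fin n → Subset n
  below v = tabulate (λ u → toℕ (key u) ℕ.<ᵇ toℕ (key v))

  ∈below : ∀ {u v} → key u Fin.< key v → u ∈ₛ below v
  ∈below {u} {v} u<v =
    lookup⇒[]= u (below v) (trans (lookup∘tabulate _ u) (Equivalence.to T-≡ (ℕ.<⇒<ᵇ u<v)))

  ∈below⁻ : ∀ {u v} → u ∈ₛ below v → key u Fin.< key v
  ∈below⁻ {u} {v} u∈ =
    ℕ.<ᵇ⇒< _ _ (Equivalence.from T-≡ (trans (sym (lookup∘tabulate _ u)) ([]=⇒lookup u∈)))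

  ∉below-self : ∀ v → v ∉ₛ below v
  ∉below-self v v∈ = ℕ.<-irrefl refl (∈below⁻ v∈)

  below-⊂ : ∀ {v w} → key v Fin.< key w → below v ⊂ below w
  below-⊂ v<w = (λ u∈ → ∈below (ℕ.<-trans (∈below⁻ u∈) v<w)) , _ , ∈below v<w , ∉below-self _

  rank : Fin n → ℕ
  rank v = ∣ below v ∣

  rank<n : ∀ v → rank v ℕ.< n
  rank<n v = subst (rank v ℕ.<_) (∣⊤∣≡n n) (p⊂q⇒∣p∣<∣q∣ ((λ _ → ∈⊤) , v , ∈⊤ , ∉below-self v))

  rank-mono : ∀ {v w} → key v Fin.< key w → rank v ℕ.< rank w
  rank-mono v<w = p⊂q⇒∣p∣<∣q∣ (below-⊂ v<w)

  position : Fin n → Fin n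
  position v = Fin.fromℕ< (rank<n v)

  position-mono : ∀ {v w} → key v Fin.< key w → position v Fin.< position w
  position-mono {v} {w} v<w =
    subst₂ ℕ._<_ (sym (Fin.toℕ-fromℕ< (rank<n v))) (sym (Fin.toℕ-fromℕ< (rank<n w))) (rank-mono v<w)

  position-inj : Injective _≡_ _≡_ position
  position-inj {v} {w} eq with Fin.<-cmp (key v) (key w)
  ... | tri< v<w _ _ = contradiction (cong toℕ eq) (ℕ.<⇒≢ (position-mono v<w))
  ... | tri≈ _ v≡w _ = key-inj v≡w
  ... | tri> _ _ w<v = contradiction (cong toℕ (sym eq)) (ℕ.<⇒≢ (position-mono w<v))

  order : LinOrder n
  order = fromInjection position position-inj

  order-mono : ∀ {v w} → key v Fin.< key w → v ≺[ order ] w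
  order-mono = position-mono

-- The reverse of a linear ordering (compose positions with i ↦ n-1-i); it
-- exchanges "x before v and w" with "x after v and w".
reverseOrder : ∀ {n} → LinOrder n → LinOrder n
reverseOrder π = π ∘ₚ reverse

opposite-< : ∀ {n} {a b : Fin n} → a Fin.< b → opposite b Fin.< opposite a
opposite-< {n} {a} {b} a<b =
  subst₂ ℕ._<_ (sym (opposite-prop b)) (sym (opposite-prop a)) (ℕ.∸-monoʳ-< (s≤s a<b) (toℕ<n b))

reverse-⇒ : ∀ {n} (π : LinOrder n) {v w} → w ≺[ π ] v → v ≺[ reverseOrder π ] w
reverse-⇒ π = opposite-<

reverse-⇐ : ∀ {n} (π : LinOrder n) {v w} → v ≺[ reverseOrder π ] w → w ≺[ π ] v
reverse-⇐ π {v} {w} lt =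
  subst₂ Fin._<_ (opposite-involutive _) (opposite-involutive _) (opposite-< lt)

combine-monoʳ-< : ∀ {m n} (i : Fin m) {j k : Fin n} → j Fin.< k → combine i j Fin.< combine i k
combine-monoʳ-< {n = n} i {j} {k} j<k =
  subst₂ ℕ._<_ (sym (Fin.toℕ-combine i j)) (sym (Fin.toℕ-combine i k)) (ℕ.+-monoʳ-< (n * toℕ i) j<k)

Front : ∀ {n} → LinOrder n → Fin n → Fin n → Fin n → Set
Front π x v w = x ≺[ π ] v × x ≺[ π ] w

Back : ∀ {n} → LinOrder n → Fin n → Fin n → Fin n → Set
Back π x v w = v ≺[ π ] x × w ≺[ π ] x

module ClassOrders {n χ : ℕ} (col : Fin n → Fin χ) where

  classBit : Fin χ → Fin n → Fin 2
  classBit c v = if does (col v Fin.≟ c) then Fin.zero else Fin.suc Fin.zero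

  classBit-in : ∀ {c v} → col v ≡ c → classBit c v ≡ Fin.zero
  classBit-in {c} {v} e = cong (λ b → if b then _ else _) (dec-true (col v Fin.≟ c) e)

  classBit-out : ∀ {c v} → ¬ col v ≡ c → classBit c v ≡ Fin.suc Fin.zero
  classBit-out {c} {v} ne = cong (λ b → if b then _ else _) (dec-false (col v Fin.≟ c) ne)

  -- the lexicographic key (class bit, index), encoded in Fin (2 * n)
  key : Fin χ → Fin n → Fin (2 * n)
  key c v = combine (classBit c v) v

  key-inj : ∀ c → Injective _≡_ _≡_ (key c)
  key-inj c {v} {w} = Fin.combine-injectiveʳ (classBit c v) v (classBit c w) w

  firstOrder : Fin χ → LinOrder n
  firstOrder c = OrderByKey.order (key c) (key-inj c)

  lastOrder : Fin χ → LinOrder n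
  lastOrder c = reverseOrder (firstOrder c)

  class-first : ∀ {c x y} → col x ≡ c → ¬ col y ≡ c → x ≺[ firstOrder c ] y
  class-first {c} {x} {y} x∈c y∉c = OrderByKey.order-mono (key c) (key-inj c)
    (Fin.combine-monoˡ-< x y (subst₂ Fin._<_ (sym (classBit-in x∈c)) (sym (classBit-out y∉c)) ℕ.z<s))

  same-class : ∀ {c x y} → classBit c x ≡ classBit c y → x Fin.< y → x ≺[ firstOrder c ] y
  same-class {c} {x} {y} same x<y = OrderByKey.order-mono (key c) (key-inj c)
    (subst (λ b → combine (classBit c x) x Fin.< combine b y) same (combine-monoʳ-< (classBit c x) x<y))

  both-in : ∀ {c x y} → col x ≡ c → col y ≡ c → classBit c x ≡ classBit c y
  both-in x∈c y∈c = trans (classBit-in x∈c) (sym (classBit-in y∈c))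

  both-out : ∀ {c x y} → ¬ col x ≡ c → ¬ col y ≡ c → classBit c x ≡ classBit c y
  both-out x∉c y∉c = trans (classBit-out x∉c) (sym (classBit-out y∉c))

  FrontSomewhere : Fin n → Fin n → Fin n → Set
  FrontSomewhere x v w = ∃ λ c → Front (firstOrder c) x v w ⊎ Front (lastOrder c) x v w

  -- The heart of the construction, when x and w have different colours (x≁w).
  -- If x and v also differ in colour, firstOrder (col x) puts x first.
  -- Otherwise x and v share a class: if x has the smaller index then
  -- firstOrder (col x) works; if v has, then lastOrder (col w) puts w last
  -- and the remaining vertices, including x and v, in decreasing index order.
  front-unlike : ∀ {x v w} → ¬ col v ≡ col w → ¬ x ≡ v → ¬ col x ≡ col w → FrontSomewhere x v w
  front-unlike {x} {v} {w} vw-proper x≢v x≁w with col x Fin.≟ col v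
  ... | no x≁v = col x , inj₁ (class-first refl (x≁v ∘ sym) , class-first refl (x≁w ∘ sym))
  ... | yes x∼v with Fin.<-cmp x v
  ...   | tri< x<v _ _ = col x , inj₁ (same-class (both-in refl (sym x∼v)) x<v , class-first refl (x≁w ∘ sym))
  ...   | tri≈ _ x≡v _ = contradiction x≡v x≢v
  ...   | tri> _ _ v<x = col w , inj₂
          ( reverse-⇒ (firstOrder (col w)) (same-class (both-out vw-proper x≁w) v<x)
          , reverse-⇒ (firstOrder (col w)) (class-first refl x≁w))

  -- if x is coloured like w it differs from v, so exchange the roles of v and w
  front : ∀ {x v w} → ¬ col v ≡ col w → ¬ x ≡ v → ¬ x ≡ w → FrontSomewhere x v w
  front {x} {v} {w} vw-proper x≢v x≢w with col x Fin.≟ col w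
  ... | no x≁w  = front-unlike vw-proper x≢v x≁w
  ... | yes x∼w = Product.map₂ (Sum.map Product.swap Product.swap)
                    (front-unlike (vw-proper ∘ sym) x≢w (λ x∼v → vw-proper (trans (sym x∼v) x∼w)))

  -- reversing the witness of front yields an order in which x comes last
  back : ∀ {x v w} → ¬ col v ≡ col w → ¬ x ≡ v → ¬ x ≡ w →
    ∃ λ c → Back (firstOrder c) x v w ⊎ Back (lastOrder c) x v w
  back vw-proper x≢v x≢w with front vw-proper x≢v x≢w
  ... | c , inj₁ (xv , xw) = c , inj₂ (reverse-⇒ (firstOrder c) xv , reverse-⇒ (firstOrder c) xw)
  ... | c , inj₂ (xv , xw) = c , inj₁ (reverse-⇐ (firstOrder c) xv , reverse-⇐ (firstOrder c) xw)

-- Strong separation for an arbitrary family of precedence relations L i;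
-- StronglySeparating G R is the instance L i = _≺[ lookup R i ]_.
BeforeBy : ∀ {n} → (Fin n → Fin n → Set) → Fin n → Fin n → Fin n → Fin n → Set
BeforeBy L v w x y = L v x × L v y × L w x × L w y

StronglySeparatingBy : ∀ {n p} → Graph n → (Fin p → Fin n → Fin n → Set) → Set
StronglySeparatingBy G L =
  (∀ v w x y → DisjointEdges G v w x y →
     ∃ λ i → BeforeBy (L i) v w x y ⊎ BeforeBy (L i) x y v w) ×
  (∀ v w x → Edge G v w → ¬ x ≡ v → ¬ x ≡ w →
     (∃ λ i → L i x v × L i x w) × (∃ λ j → L j v x × L j w x))

stronglySeparatingBy-mono : ∀ {n p} (G : Graph n) {L L′ : Fin p → Fin n → Fin n → Set} →
  (∀ i {a b} → L i a b → L′ i a b) → StronglySeparatingBy G L → StronglySeparatingBy G L′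
stronglySeparatingBy-mono G {L} {L′} grow (separate , isolate) =
  (λ v w x y vw∥xy → Product.map₂ (Sum.map before before) (separate v w x y vw∥xy)) ,
  (λ v w x vw x≢v x≢w → Product.map (Product.map₂ pair) (Product.map₂ pair) (isolate v w x vw x≢v x≢w))
  where
  pair : ∀ {i a b c d} → L i a b × L i c d → L′ i a b × L′ i c d
  pair {i} = Product.map (grow i) (grow i)
  before : ∀ {i v w x y} → BeforeBy (L i) v w x y → BeforeBy (L′ i) v w x y
  before {i} (vx , vy , wx , wy) = grow i vx , grow i vy , grow i wx , grow i wy

edge? : ∀ {n} (G : Graph n) v w → Dec (Edge G v w)
edge? G v w = adj G v w Bool.≟ true

stronglySeparatingBy? : ∀ {n p} (G : Graph n) {L : Fin p → Fin n → Fin n → Set} →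
  (∀ i a b → Dec (L i a b)) → Dec (StronglySeparatingBy G L)
stronglySeparatingBy? G {L} L? =
  all? (λ v → all? (λ w → all? (λ x → all? (λ y → disjoint? v w x y →-dec
    any? (λ i → before? i v w x y ⊎-dec before? i x y v w))))) ×-dec
  all? (λ v → all? (λ w → all? (λ x → edge? G v w →-dec ¬? (x Fin.≟ v) →-dec ¬? (x Fin.≟ w) →-dec
    (any? (λ i → L? i x v ×-dec L? i x w) ×-dec any? (λ j → L? j v x ×-dec L? j w x)))))
  where
  disjoint? : ∀ v w x y → Dec (DisjointEdges G v w x y)
  disjoint? v w x y = edge? G v w ×-dec edge? G x y ×-dec ¬? (v Fin.≟ x) ×-dec ¬? (v Fin.≟ y)
    ×-dec ¬? (w Fin.≟ x) ×-dec ¬? (w Fin.≟ y)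
  before? : ∀ i v w x y → Dec (BeforeBy (L i) v w x y)
  before? i v w x y = L? i v x ×-dec L? i v y ×-dec L? i w x ×-dec L? i w y

injective? : ∀ {n m} (f : Fin n → Fin m) → Dec (Injective _≡_ _≡_ f)
injective? f = map′ (λ inj {a} {b} → inj a b) (λ inj a b → inj)
  (all? (λ a → all? (λ b → (f a Fin.≟ f b) →-dec (a Fin.≟ b))))

Searchable : Set → Set₁
Searchable A = ∀ {P : A → Set} → (∀ a → Dec (P a)) → Dec (∃ P)

search-Vec : ∀ {A} → Searchable A → ∀ k → Searchable (Vec A k)
search-Vec search-A zero {P} P? = map′ ([] ,_) (λ { ([] , p) → p }) (P? [])
search-Vec search-A (suc k) {P} P? =
  map′ (λ { (a , as , p) → a ∷ as , p }) (λ { (a ∷ as , p) → a , as , p })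
    (search-A (λ a → search-Vec search-A k (λ as → P? (a ∷ as))))

-- A representation is determined, up to its precedence relations, by the
-- table of vertex positions in each of its orderings; there are finitely
-- many tables, so existence of a strongly separating one is decidable.
Tables : ℕ → ℕ → Set
Tables n p = Vec (Vec (Fin n) n) p

TableOrder : ∀ {n p} → Tables n p → Fin p → Fin n → Fin n → Set
TableOrder T i a b = lookup (lookup T i) a Fin.< lookup (lookup T i) b

Realises : ∀ {n p} → Graph n → Tables n p → Set
Realises G T = (∀ i → Injective _≡_ _≡_ (lookup (lookup T i))) × StronglySeparatingBy G (TableOrder T)

fromTables : ∀ {n p} (G : Graph n) (T : Tables n p) → Realises G T → Σ (Rep n p) (StronglySeparating G)
fromTables G T (inj , sep) = R , stronglySeparatingBy-mono G realise sep
  where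
  R : Rep _ _
  R = tabulate (λ i → fromInjection (lookup (lookup T i)) (inj i))
  realise : ∀ i {a b} → TableOrder T i a b → a ≺[ lookup R i ] b
  realise i {a} {b} = subst (λ π → a ≺[ π ] b) (sym (lookup∘tabulate _ i))

toTables : ∀ {n p} (G : Graph n) (R : Rep n p) → StronglySeparating G R → ∃ (Realises G)
toTables G R sep = T , (λ i → injective i) , stronglySeparatingBy-mono G tabulated sep
  where
  T : Tables _ _
  T = tabulate (λ i → tabulate (lookup R i ⟨$⟩ʳ_))
  entry : ∀ i a → lookup (lookup T i) a ≡ lookup R i ⟨$⟩ʳ a
  entry i a = trans (cong (λ t → lookup t a) (lookup∘tabulate _ i)) (lookup∘tabulate _ a)
  injective : ∀ i → Injective _≡_ _≡_ (lookup (lookup T i))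
  injective i {a} {b} e = begin
    a                                             ≡⟨ inverseˡ (lookup R i) ⟨
    lookup R i ⟨$⟩ˡ (lookup R i ⟨$⟩ʳ a)          ≡⟨ cong (lookup R i ⟨$⟩ˡ_) (trans (sym (entry i a)) (trans e (entry i b))) ⟩
    lookup R i ⟨$⟩ˡ (lookup R i ⟨$⟩ʳ b)          ≡⟨ inverseˡ (lookup R i) ⟩
    b                                             ∎
    where open ≡-Reasoning
  tabulated : ∀ i {a b} → a ≺[ lookup R i ] b → TableOrder T i a b
  tabulated i {a} {b} = subst₂ Fin._<_ (sym (entry i a)) (sym (entry i b))

hasStrongSepRep? : ∀ {n} (G : Graph n) p → Dec (HasStrongSepRep G p)
hasStrongSepRep? {n} G p = (1 ℕ.≤? p) ×-dec
  map′ (λ { (T , r) → fromTables G T r }) (λ { (R , sep) → toTables G R sep })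
    (search-Vec (search-Vec any? n) p (λ T → realises? T))
  where
  realises? : (T : Tables n p) → Dec (Realises G T)
  realises? T = all? (λ i → injective? (lookup (lookup T i)))
    ×-dec stronglySeparatingBy? G (λ i a b → lookup (lookup T i) a Fin.<? lookup (lookup T i) b)

Least : (ℕ → Set) → Set
Least P = ∃ λ s → P s × (∀ p → P p → s ≤ p)

least : ∀ {P : ℕ → Set} → (∀ p → Dec (P p)) → ∀ {B} → P B → Least P
least {P} P? {B} PB = scan 0 B (λ _ ()) (subst P (sym (ℕ.+-identityʳ B)) PB)
  where
  -- scan k m: no p < k has P, and P (m + k) holds
  scan : ∀ k m → (∀ p → p ℕ.< k → ¬ P p) → P (m + k) → Least P
  scan k m none-below P[m+k] with P? k
  ... | yes Pk = k , Pk , λ p Pp → ℕ.≮⇒≥ (λ p<k → none-below p p<k Pp)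
  scan k zero    none-below Pk      | no ¬Pk = contradiction Pk ¬Pk
  scan k (suc m) none-below P[m+k]  | no ¬Pk =
    scan (suc k) m none-up-to-k (subst P (sym (ℕ.+-suc m k)) P[m+k])
    where
    none-up-to-k : ∀ p → p ℕ.< suc k → ¬ P p
    none-up-to-k p p<1+k with ℕ.m<1+n⇒m<n∨m≡n p<1+k
    ... | inj₁ p<k  = none-below p p<k
    ... | inj₂ refl = ¬Pk

strongSepDim-≤ : ∀ {n} (G : Graph n) {B} → HasStrongSepRep G B → ∃ λ s → IsStrongSepDim G s × s ≤ B
strongSepDim-≤ G {B} rep with least (hasStrongSepRep? G) rep
... | s , has-s , minimal = s , (has-s , minimal) , minimal B rep

-- A list containing the injectively indexed elements f 0, …, f (k-1) has
-- length at least k (send i to the position of f i in the list).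
members-≤-length : ∀ {A : Set} {k} {xs : List A} (f : Fin k → A) → Injective _≡_ _≡_ f →
  (∀ i → f i ∈ xs) → k ≤ List.length xs
members-≤-length {xs = xs} f f-inj f∈xs = injective⇒≤ {f = position} position-inj
  where
  position : _ → Fin (List.length xs)
  position i = Any.index (f∈xs i)
  position-inj : Injective _≡_ _≡_ position
  position-inj {i} {j} e = f-inj (begin
    f i                           ≡⟨ lookup-index (f∈xs i) ⟩
    List.lookup xs (position i)   ≡⟨ cong (List.lookup xs) e ⟩
    List.lookup xs (position j)   ≡⟨ lookup-index (f∈xs j) ⟨
    f j                           ∎)
    where open ≡-Reasoning

Proper : ∀ {n χ} → Graph n → (Fin n → Fin χ) → Set
Proper G col = ∀ u w → Edge G u w → ¬ col u ≡ col w

-- With maximum degree at most Δ, some of Δ+1 colours is missing around v: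
-- otherwise choosing a neighbour of each colour exhibits Δ+1 distinct
-- neighbours.
freeColour : ∀ {n Δ} (G : Graph n) → (∀ v → degree G v ≤ Δ) → (col : Fin n → Fin (suc Δ)) →
  ∀ v → ∃ λ c → ∀ u → Edge G v u → ¬ col u ≡ c
freeColour {n} {Δ} G degree≤Δ col v
  with any? (λ c → all? (λ u → edge? G v u →-dec ¬? (col u Fin.≟ c)))
... | yes free = free
... | no none-free = contradiction (ℕ.≤-trans (members-≤-length neighbour neighbour-inj neighbour∈) (degree≤Δ v))
                                   (ℕ.<-irrefl refl)
  where
  taken : ∀ c → ∃ λ u → Edge G v u × col u ≡ c
  taken c with any? (λ u → edge? G v u ×-dec (col u Fin.≟ c))
  ... | yes t = t
  ... | no ¬t = contradiction (c , λ u vu cu≡c → ¬t (u , vu , cu≡c)) none-free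
  neighbour : Fin (suc Δ) → Fin n
  neighbour c = proj₁ (taken c)
  neighbour-inj : Injective _≡_ _≡_ neighbour
  neighbour-inj {c} {c′} e =
    trans (sym (proj₂ (proj₂ (taken c)))) (trans (cong col e) (proj₂ (proj₂ (taken c′))))
  neighbour∈ : ∀ c → neighbour c ∈ filter (λ w → T? (adj G v w)) (allFin n)
  neighbour∈ c = ∈-filter⁺ (λ w → T? (adj G v w)) (∈-allFin _)
    (Equivalence.from T-≡ (proj₁ (proj₂ (taken c))))

recolour : ∀ {n χ} → Fin n → Fin χ → (Fin n → Fin χ) → Fin n → Fin χ
recolour v c col u = if does (u Fin.≟ v) then c else col u

ProperBelow : ∀ {n χ} → Graph n → ℕ → (Fin n → Fin χ) → Set
ProperBelow G k col = ∀ u w → Edge G u w → toℕ u ℕ.< k → toℕ w ℕ.< k → ¬ col u ≡ col w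

-- Greedy colouring: give vertex k a colour missing among its neighbours.
-- (Matching on u ≟ k and w ≟ k makes recolour compute in each case.)
greedy-step : ∀ {n χ k} (G : Graph n) {col : Fin n → Fin χ} (k<n : k ℕ.< n) {c : Fin χ} →
  ProperBelow G k col → (∀ u → Edge G (Fin.fromℕ< k<n) u → ¬ col u ≡ c) →
  ProperBelow G (suc k) (recolour (Fin.fromℕ< k<n) c col)
greedy-step {k = k} G {col} k<n {c} proper free u w uw u<1+k w<1+k
  with u Fin.≟ Fin.fromℕ< k<n | w Fin.≟ Fin.fromℕ< k<n
... | yes u≡v | yes w≡v = λ _ → no-loop (subst₂ (Edge G) u≡v w≡v uw)
  where
  no-loop : ¬ Edge G (Fin.fromℕ< k<n) (Fin.fromℕ< k<n)
  no-loop e with trans (sym e) (irrefl G _)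
  ... | ()
... | yes u≡v | no _    = λ c≡col-w → free w (subst (λ x → Edge G x w) u≡v uw) (sym c≡col-w)
... | no _    | yes w≡v = free u (subst (λ x → Edge G x u) w≡v (trans (Graph.sym G w u) uw))
... | no u≢v  | no w≢v  = proper u w uw (earlier u<1+k u≢v) (earlier w<1+k w≢v)
  where
  earlier : ∀ {x} → toℕ x ℕ.< suc k → ¬ x ≡ Fin.fromℕ< k<n → toℕ x ℕ.< k
  earlier {x} x<1+k x≢v with ℕ.m<1+n⇒m<n∨m≡n x<1+k
  ... | inj₁ x<k = x<k
  ... | inj₂ x≡k = contradiction (toℕ-injective (trans x≡k (sym (Fin.toℕ-fromℕ< k<n)))) x≢v

greedy-colouring : ∀ {n Δ} (G : Graph n) → (∀ v → degree G v ≤ Δ) →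
  Σ (Fin n → Fin (suc Δ)) (Proper G)
greedy-colouring {n} {Δ} G degree≤Δ =
  let col , proper = colour-first n ℕ.≤-refl
  in  col , λ u w uw → proper u w uw (toℕ<n u) (toℕ<n w)
  where
  colour-first : ∀ k → k ≤ n → Σ (Fin n → Fin (suc Δ)) (ProperBelow G k)
  colour-first zero    _   = (λ _ → Fin.zero) , λ _ _ _ ()
  colour-first (suc k) k<n with colour-first k (ℕ.<⇒≤ k<n)
  ... | col , proper with freeColour G degree≤Δ col (Fin.fromℕ< k<n)
  ...   | c , free = recolour (Fin.fromℕ< k<n) c col , greedy-step G k<n proper free

VertexEdgeSeparating : ∀ {n p} → Graph n → Rep n p → Set
VertexEdgeSeparating G R = ∀ v w x → Edge G v w → ¬ x ≡ v → ¬ x ≡ w →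
  (∃ λ i → Front (lookup R i) x v w) × (∃ λ j → Back (lookup R j) x v w)

module _ {A : Set} (P : A → Set) where

  ∃-++ˡ : ∀ {k l} (xs : Vec A k) (ys : Vec A l) → ∃ (λ i → P (lookup xs i)) → ∃ (λ i → P (lookup (xs ++ ys) i))
  ∃-++ˡ {l = l} xs ys (i , p) = i Fin.↑ˡ l , subst P (sym (lookup-++ˡ xs ys i)) p

  ∃-++ʳ : ∀ {k l} (xs : Vec A k) (ys : Vec A l) → ∃ (λ i → P (lookup ys i)) → ∃ (λ i → P (lookup (xs ++ ys) i))
  ∃-++ʳ {k} xs ys (i , p) = k Fin.↑ʳ i , subst P (sym (lookup-++ʳ xs ys i)) p

  ∃-tabulate : ∀ {k} (f : Fin k → A) i → P (f i) → ∃ (λ j → P (lookup (tabulate f) j))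
  ∃-tabulate f i p = i , subst P (sym (lookup∘tabulate f i)) p

strongly-separating-++ : ∀ {n p q} (G : Graph n) (R : Rep n p) (E : Rep n q) →
  Separating G R → VertexEdgeSeparating G E → StronglySeparating G (R ++ E)
strongly-separating-++ G R E separate isolate =
  (λ v w x y vw∥xy → ∃-++ˡ (λ π → Before π v w x y ⊎ Before π x y v w) R E (separate v w x y vw∥xy)) ,
  (λ v w x vw x≢v x≢w → Product.map (∃-++ʳ (λ π → Front π x v w) R E) (∃-++ʳ (λ π → Back π x v w) R E)
                          (isolate v w x vw x≢v x≢w))

classOrders : ∀ {n χ} → (Fin n → Fin χ) → Rep n (χ + χ)
classOrders col = tabulate firstOrder ++ tabulate lastOrder
  where open ClassOrders col

classOrders-isolate : ∀ {n χ} (G : Graph n) {col : Fin n → Fin χ} → Proper G col →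
  VertexEdgeSeparating G (classOrders col)
classOrders-isolate G {col} proper v w x vw x≢v x≢w =
  among (λ π → Front π x v w) (front vw-proper x≢v x≢w) , among (λ π → Back π x v w) (back vw-proper x≢v x≢w)
  where
  open ClassOrders col
  vw-proper : ¬ col v ≡ col w
  vw-proper = proper v w vw
  among : ∀ (P : LinOrder _ → Set) → ∃ (λ c → P (firstOrder c) ⊎ P (lastOrder c)) →
    ∃ λ i → P (lookup (classOrders col) i)
  among P (c , inj₁ p) = ∃-++ˡ P (tabulate firstOrder) (tabulate lastOrder) (∃-tabulate P firstOrder c p)
  among P (c , inj₂ p) = ∃-++ʳ P (tabulate firstOrder) (tabulate lastOrder) (∃-tabulate P lastOrder c p)

strengthen : ∀ {n χ d} (G : Graph n) {col : Fin n → Fin χ} → Proper G col →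
  HasSepRep G d → HasStrongSepRep G (d + (χ + χ))
strengthen G {col} proper (1≤d , R , separate) =
  ℕ.≤-trans 1≤d (ℕ.m≤m+n _ _) , R ++ classOrders col ,
  strongly-separating-++ G R (classOrders col) separate (classOrders-isolate G proper)

lemma7 : ∀ {n} (G : Graph n) (Δ d : ℕ) → MaxDegree G Δ → IsSepDim G d →
    ∃[ s ] (IsStrongSepDim G s × s ≤ d + 2 * Δ + 2)
lemma7 G Δ d (degree≤Δ , _) (sepRep , _) =
  let col , proper = greedy-colouring G degree≤Δ
      s , isDim , s≤bound = strongSepDim-≤ G (strengthen G proper sepRep)
  in  s , isDim , subst (s ≤_) (size d Δ) s≤bound
  where
  size : ∀ d Δ → d + (suc Δ + suc Δ) ≡ d + 2 * Δ + 2
  size = solve-∀
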